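{- Let $r\ge 2$ and let $\lambda=(\lambda_1,\dots,\lambda_s)$ be a partition having exactly $r-1$ non-empty successive Durfee squares, of sides $d_1,\dots,d_{r-1}\geq 1$ with $d_1+\dots+d_{r-1}=s$. Let $b_1,b_2,\dots$ be the sides of its successive bottom squares, and set $h^B_j=b_1+\dots+b_j$, $h^D_j=d_{r-1}+d_{r-2}+\dots+d_{r-j}$ for $1\le j\le r-1$, and $h^D_r=+\infty$. Then for all $1\leq j\leq r-1$, $$h^D_j\leq h^B_j<h^D_{j+1},$$ and $h^D_j=h^B_j$ holds if and only if, for every $k\in\{r-j,\dots,r-1\}$, the partition $\mu_k$ has strictly fewer than $d_k$ parts.
   Context: A partition is a non-increasing finite sequence of positive integers; row $m$ of the Young diagram (from the top) has $\lambda_m$ boxes. For a (possibly empty) partition $\mu=(\mu_1,\dots,\mu_t)$ let $\mathrm{sq}(\mu)=\max\{d\ge0: d\le t,\ \mu_d\ge d\}$. The successive Durfee squares of $\lambda$: $\mu^{(0)}=\lambda$, $d_j=\mathrm{sq}(\mu^{(j-1)})$, and $\mu^{(j)}$ is $\mu^{(j-1)}$ with its first $d_j$ parts deleted; the $j$-th Durfee square occupies rows $d_1+\dots+d_{j-1}+1,\dots,d_1+\dots+d_j$ and columns $1,\dots,d_j$. The partition $\mu_k$ to the right of the $k$-th Durfee square consists of the positive numbers $\lambda_m-d_k$ for $m$ ranging over the rows of the $k$-th Durfee square. Successive bottom squares: $\nu^{(0)}=\lambda$; for $j\ge1$, if $\nu^{(j-1)}=(\nu_1,\dots,\nu_t)$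 is nonempty then $b_j=\nu_t$ (its smallest part) and $\nu^{(j)}$ is obtained by deleting the last $\min(\nu_t,t)$ parts; if $\nu^{(j-1)}$ is empty then $b_j=0$ and $\nu^{(j)}$ is empty. -}

module Defs where

open import Data.Nat using (ℕ; zero; suc; _+_; _∸_; _≤_; _<_; _⊔_; _⊓_; _≤?_; _<?_)
open import Data.List using (List; []; _∷_; length; drop; take; reverse; map; filter)
open import Data.List.Relation.Unary.All using (All)
open import Data.List.Relation.Unary.Linked using (Linked)
open import Data.Nat using (_≥_)
open import Relation.Nullary.Decidable using (does)
open import Data.Bool using (if_then_else_)

IsPartition : List ℕ → Set
IsPartition λ′ = All (λ x → 1 ≤ x) λ′ × Linked _≥_ λ′
  where open import Data.Product using (_×_)

-- sqFrom k μ = max ({0} ∪ {d : μ's d-th part (1-based, with the head of μ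
-- being part number k) satisfies μ_d ≥ d})
sqFrom : ℕ → List ℕ → ℕ
sqFrom k [] = 0
sqFrom k (x ∷ xs) = if does (k ≤? x) then k ⊔ sqFrom (suc k) xs else sqFrom (suc k) xs

sq : List ℕ → ℕ
sq μ = sqFrom 1 μ

muRem : List ℕ → ℕ → List ℕ
muRem λ′ zero = λ′
muRem λ′ (suc j) = drop (sq (muRem λ′ j)) (muRem λ′ j)

dSide : List ℕ → ℕ → ℕ
dSide λ′ zero = 0
dSide λ′ (suc j) = sq (muRem λ′ j)

muRight : List ℕ → ℕ → List ℕ
muRight λ′ k = filter (λ x → 0 <? x) (map (λ x → x ∸ dSide λ′ k) (take (dSide λ′ k) (muRem λ′ (k ∸ 1))))

lastPart : List ℕ → ℕ
lastPart ν with reverse ν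
... | [] = 0
... | x ∷ _ = x

dropLast : ℕ → List ℕ → List ℕ
dropLast n ν = reverse (drop n (reverse ν))

nuRem : List ℕ → ℕ → List ℕ
nuRem λ′ zero = λ′
nuRem λ′ (suc j) = dropLast (lastPart (nuRem λ′ j) ⊓ length (nuRem λ′ j)) (nuRem λ′ j)

bSide : List ℕ → ℕ → ℕ
bSide λ′ zero = 0
bSide λ′ (suc j) = lastPart (nuRem λ′ j)

sumTo : (ℕ → ℕ) → ℕ → ℕ
sumTo f zero = 0
sumTo f (suc j) = sumTo f j + f (suc j)

hB : List ℕ → ℕ → ℕ
hB λ′ j = sumTo (bSide λ′) j

hD : List ℕ → ℕ → ℕ → ℕ
hD λ′ r j = sumTo (λ i → dSide λ′ (r ∸ i)) j

module Submission where

-- Number the rows of λ from 0, write n = r − 1 and D_k = d_1 + ⋯ + d_k, so that the k-th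
-- Durfee square occupies rows D_{k−1}, …, D_k − 1; rows above its bottom have length ≥ d_k
-- and rows below it have length ≤ d_k. By induction on j, the partition ν^(j) left after j
-- bottom squares has t_j = s − h^B_j rows with D_{k−1} < t_j ≤ D_k for k = n − j (this is
-- h^D_j ≤ h^B_j < h^D_{j+1}), so its smallest part b_{j+1} is a row of the k-th square and
-- d_k ≤ b_{j+1} ≤ d_{k−1}, which carries the invariant to j + 1. Moreover h^D_{j+1} = h^B_{j+1}
-- iff h^D_j = h^B_j (so t_j = D_k) and b_{j+1} = d_k, i.e. the last row of the k-th Durfee
-- square has length d_k, which says exactly that μ_k has fewer than d_k parts.

open import Defs
open import Data.Nat using (ℕ; _≤_; _<_; _∸_; _+_)
open import Data.Nat using (zero; suc; z≤n; s≤s; _≥_; _⊓_; _⊔_; _≤ᵇ_; _≤?_; _<?_)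
open import Data.List using (List; length)
open import Data.Product using (_×_; _,_)
open import Function.Bundles using (_⇔_; mk⇔; Equivalence)
open import Relation.Binary.PropositionalEquality using (_≡_)

open import Data.Bool using (true; false)
open import Data.Sum using (inj₁; inj₂)
open import Data.Empty using (⊥-elim)
open import Data.List using ([]; _∷_; _++_; _∷ʳ_; drop; take; reverse; map; filter; initLast; _∷ʳ′_)
open import Data.List.Properties using (length-map; length-++; drop-drop; take-all; length-take; length-drop; length-reverse; take-take; take++drop≡id; drop-all; reverse-++; reverse-involutive; filter-all; filter-notAll)
open import Data.List.Relation.Unary.All as All using (All; []; _∷_)
import Data.List.Relation.Unary.All.Properties as All
open import Data.List.Relation.Unary.Any as Any using (Any; here; there)
import Data.List.Relation.Unary.Any.Properties as Any
open import Data.List.Relation.Unary.Linked as Linked using (Linked; _∷_)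
open import Data.Nat.Properties
open import Algebra.Properties.CommutativeSemigroup +-commutativeSemigroup using (x∙yz≈y∙xz)
open import Relation.Binary.Core using (Rel)
open import Relation.Binary.PropositionalEquality using (refl; sym; trans; cong; cong₂; subst; module ≡-Reasoning)
open import Relation.Nullary using (yes; no; ofʸ; ofⁿ; ¬_)

+≡+⇒≤ : ∀ {a x c y} → a + x ≡ c + y → y ≤ x → a ≤ c
+≡+⇒≤ {a} {x} {c} {y} eq y≤x = +-cancelʳ-≤ x a c (begin
  a + x   ≡⟨ eq ⟩
  c + y   ≤⟨ +-monoʳ-≤ c y≤x ⟩
  c + x   ∎)
  where open ≤-Reasoning

+≡+⇒> : ∀ {a x p z} → a + x ≡ p + z → x < z → p < a
+≡+⇒> {a} {x} {p} {z} eq x<z = +-cancelʳ-< x p a (begin-strict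
  p + x   <⟨ +-monoʳ-< p x<z ⟩
  p + z   ≡⟨ eq ⟨
  a + x   ∎)
  where open ≤-Reasoning

+-≡-split : ∀ {a b c e} → a ≤ b → c ≤ e → a + c ≡ b + e → a ≡ b × c ≡ e
+-≡-split {a} {b} {c} {e} a≤b c≤e eq = a≡b , +-cancelˡ-≡ a c e (trans eq (cong (_+ e) (sym a≡b)))
  where
  a≡b : a ≡ b
  a≡b = ≤-antisym a≤b (+≡+⇒≤ (sym eq) c≤e)

sumTo-≥-last : ∀ f k → 1 ≤ k → f k ≤ sumTo f k
sumTo-≥-last f (suc k) _ = m≤n+m (f (suc k)) (sumTo f k)

sumTo-reverse+sumTo : ∀ f n j → j ≤ n → sumTo (λ i → f (suc n ∸ i)) j + sumTo f (n ∸ j) ≡ sumTo f n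
sumTo-reverse+sumTo f n zero    _   = refl
sumTo-reverse+sumTo f n (suc j) j<n = begin
  R j + f (n ∸ j) + sumTo f k       ≡⟨ +-assoc (R j) (f (n ∸ j)) (sumTo f k) ⟩
  R j + (f (n ∸ j) + sumTo f k)     ≡⟨ cong (R j +_) (+-comm (f (n ∸ j)) (sumTo f k)) ⟩
  R j + (sumTo f k + f (n ∸ j))     ≡⟨ cong (λ m → R j + (sumTo f k + f m)) n∸j≡1+k ⟩
  R j + sumTo f (suc k)             ≡⟨ cong (λ m → R j + sumTo f m) n∸j≡1+k ⟨
  R j + sumTo f (n ∸ j)             ≡⟨ sumTo-reverse+sumTo f n j (<⇒≤ j<n) ⟩
  sumTo f n                         ∎
  where
  open ≡-Reasoning
  R : ℕ → ℕ
  R = sumTo (λ i → f (suc n ∸ i))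
  k : ℕ
  k = n ∸ suc j
  n∸j≡1+k : n ∸ j ≡ suc k
  n∸j≡1+k = +-∸-assoc 1 j<n

-- row xs i is the length of row i + 1 of the diagram, and 0 below its last row.
row : List ℕ → ℕ → ℕ
row []       _       = 0
row (x ∷ xs) zero    = x
row (x ∷ xs) (suc i) = row xs i

row-drop : ∀ n xs i → row (drop n xs) i ≡ row xs (n + i)
row-drop zero    xs       i = refl
row-drop (suc n) []       i = refl
row-drop (suc n) (x ∷ xs) i = row-drop n xs i

row-take : ∀ t xs {i} → i < t → row (take t xs) i ≡ row xs i
row-take (suc t) []       _         = refl
row-take (suc t) (x ∷ xs) {zero}  _ = refl
row-take (suc t) (x ∷ xs) {suc i} (s≤s i<t) = row-take t xs i<t

row-++ : ∀ xs ys i → row (xs ++ ys) (length xs + i) ≡ row ys i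
row-++ []       ys i = refl
row-++ (x ∷ xs) ys i = row-++ xs ys i

row-pos⇒<length : ∀ xs i → 1 ≤ row xs i → i < length xs
row-pos⇒<length (x ∷ xs) zero    _   = s≤s z≤n
row-pos⇒<length (x ∷ xs) (suc i) pos = s≤s (row-pos⇒<length xs i pos)

row-antitone : ∀ {xs} → Linked _≥_ xs → ∀ {i j} → i ≤ j → row xs j ≤ row xs i
row-antitone {[]}     _      _ = z≤n
row-antitone {x ∷ xs} sorted {zero}  {zero}  _ = ≤-refl
row-antitone {x ∷ []} sorted {zero}  {suc j} _ = z≤n
row-antitone {x ∷ y ∷ xs} (x≥y ∷ sorted) {zero} {suc j} _ =
  ≤-trans (row-antitone sorted {0} {j} z≤n) x≥y
row-antitone {x ∷ xs} sorted {suc i} {suc j} (s≤s i≤j) = row-antitone (Linked.tail sorted) i≤j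

Linked-drop : ∀ {a ℓ} {A : Set a} {R : Rel A ℓ} n {xs} → Linked R xs → Linked R (drop n xs)
Linked-drop zero    sorted = sorted
Linked-drop (suc n) {[]}     sorted = sorted
Linked-drop (suc n) {x ∷ xs} sorted = Linked-drop n (Linked.tail sorted)

take-suc-bounded : ∀ {μ} → Linked _≥_ μ → ∀ i → All (row μ i ≤_) (take (suc i) μ)
take-suc-bounded {[]}     _      i       = []
take-suc-bounded {x ∷ xs} _      zero    = ≤-refl ∷ []
take-suc-bounded {x ∷ xs} sorted (suc i) =
  row-antitone sorted {0} {suc i} z≤n ∷ take-suc-bounded (Linked.tail sorted) i

Any-take-suc : ∀ {P : ℕ → Set} μ i → i < length μ → P (row μ i) → Any P (take (suc i) μ)
Any-take-suc (x ∷ xs) zero    _           px = here px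
Any-take-suc (x ∷ xs) (suc i) (s≤s i<len) px = there (Any-take-suc xs i i<len px)

lastPart-∷ʳ : ∀ xs (x : ℕ) → lastPart (xs ∷ʳ x) ≡ x
lastPart-∷ʳ xs x rewrite reverse-++ xs (x ∷ []) = refl

lastPart≡row : ∀ xs → lastPart xs ≡ row xs (length xs ∸ 1)
lastPart≡row xs with initLast xs
... | []       = refl
... | ys ∷ʳ′ y = begin
  lastPart (ys ∷ʳ y)                          ≡⟨ lastPart-∷ʳ ys y ⟩
  row (y ∷ []) 0                              ≡⟨ sym (row-++ ys (y ∷ []) 0) ⟩
  row (ys ∷ʳ y) (length ys + 0)               ≡⟨ cong (row (ys ∷ʳ y)) index ⟩
  row (ys ∷ʳ y) (length (ys ∷ʳ y) ∸ 1)        ∎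
  where
  open ≡-Reasoning
  index : length ys + 0 ≡ length (ys ∷ʳ y) ∸ 1
  index = trans (+-identityʳ (length ys))
                (sym (trans (cong (_∸ 1) (length-++ ys)) (m+n∸n≡m (length ys) 1)))

drop-++-length : ∀ {A : Set} (xs ys : List A) → drop (length xs) (xs ++ ys) ≡ ys
drop-++-length []       ys = refl
drop-++-length (x ∷ xs) ys = drop-++-length xs ys

length-dropLast : ∀ n (xs : List ℕ) → length (dropLast n xs) ≡ length xs ∸ n
length-dropLast n xs = begin
  length (reverse (drop n (reverse xs)))  ≡⟨ length-reverse (drop n (reverse xs)) ⟩
  length (drop n (reverse xs))            ≡⟨ length-drop n (reverse xs) ⟩
  length (reverse xs) ∸ n                 ≡⟨ cong (_∸ n) (length-reverse xs) ⟩
  length xs ∸ n                           ∎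
  where open ≡-Reasoning

dropLast≡take : ∀ n xs → dropLast n xs ≡ take (length xs ∸ n) xs
dropLast≡take n xs with n ≤? length xs
... | no n≰len = begin
  reverse (drop n (reverse xs))   ≡⟨ cong reverse (drop-all n (reverse xs) len≤n) ⟩
  []                              ≡⟨ cong (λ m → take m xs) (sym (m≤n⇒m∸n≡0 (<⇒≤ (≰⇒> n≰len)))) ⟩
  take (length xs ∸ n) xs         ∎
  where
  open ≡-Reasoning
  len≤n : length (reverse xs) ≤ n
  len≤n = subst (_≤ n) (sym (length-reverse xs)) (<⇒≤ (≰⇒> n≰len))
... | yes n≤len = begin
  reverse (drop n (reverse xs))                          ≡⟨ cong (λ zs → reverse (drop n (reverse zs))) (sym (take++drop≡id m xs)) ⟩
  reverse (drop n (reverse (front ++ back)))             ≡⟨ cong (λ zs → reverse (drop n zs)) (reverse-++ front back) ⟩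
  reverse (drop n (reverse back ++ reverse front))       ≡⟨ cong (λ m → reverse (drop m (reverse back ++ reverse front))) (sym back-length) ⟩
  reverse (drop (length (reverse back)) (reverse back ++ reverse front))
                                                         ≡⟨ cong reverse (drop-++-length (reverse back) (reverse front)) ⟩
  reverse (reverse front)                                ≡⟨ reverse-involutive front ⟩
  front                                                  ∎
  where
  open ≡-Reasoning
  m : ℕ
  m = length xs ∸ n
  front back : List ℕ
  front = take m xs
  back = drop m xs
  back-length : length (reverse back) ≡ n
  back-length = trans (length-reverse back) (trans (length-drop m xs) (m∸[m∸n]≡n n≤len))

-- length (muRight lam k) unfolds to countAbove (dSide lam k) of the rows of the k-th Durfee square.
countAbove : ℕ → List ℕ → ℕ
countAbove c ys = length (filter (λ x → 0 <? x) (map (λ x → x ∸ c) ys))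

countAbove-all : ∀ c ys → All (c <_) ys → countAbove c ys ≡ length ys
countAbove-all c ys above = begin
  countAbove c ys                ≡⟨ cong length (filter-all (0 <?_) (All.map⁺ (All.map m<n⇒0<n∸m above))) ⟩
  length (map (λ x → x ∸ c) ys)  ≡⟨ length-map (λ x → x ∸ c) ys ⟩
  length ys                      ∎
  where open ≡-Reasoning

countAbove-any : ∀ c ys → Any (_≤ c) ys → countAbove c ys < length ys
countAbove-any c ys notAbove =
  subst (countAbove c ys <_) (length-map (λ x → x ∸ c) ys)
        (filter-notAll (0 <?_) (map (λ x → x ∸ c) ys) (Any.map⁺ (Any.map vanishes notAbove)))
  where
  vanishes : ∀ {x} → x ≤ c → ¬ (0 < x ∸ c)
  vanishes x≤c pos = <-irrefl (sym (m≤n⇒m∸n≡0 x≤c)) pos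

countAbove-take<⇔ : ∀ {μ} → Linked _≥_ μ → ∀ c i → i < length μ →
  countAbove c (take (suc i) μ) < suc i ⇔ row μ i ≤ c
countAbove-take<⇔ {μ} sorted c i i<len = mk⇔ to from
  where
  take-length : length (take (suc i) μ) ≡ suc i
  take-length = trans (length-take (suc i) μ) (m≤n⇒m⊓n≡m i<len)
  to : countAbove c (take (suc i) μ) < suc i → row μ i ≤ c
  to short with row μ i ≤? c
  ... | yes low = low
  ... | no above = ⊥-elim (<-irrefl (trans (countAbove-all c _ (All.map (<-≤-trans (≰⇒> above)) (take-suc-bounded sorted i))) take-length) short)
  from : row μ i ≤ c → countAbove c (take (suc i) μ) < suc i
  from low = subst (countAbove c (take (suc i) μ) <_) take-length (countAbove-any c _ (Any-take-suc μ i i<len low))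

data SquareSide (k : ℕ) (μ : List ℕ) : ℕ → Set where
  none : SquareSide k μ 0
  fits : ∀ i → i < length μ → k + i ≤ row μ i → SquareSide k μ (k + i)

SquareSide-∷ : ∀ {k x xs v} → SquareSide (suc k) xs v → SquareSide k (x ∷ xs) v
SquareSide-∷ none = none
SquareSide-∷ {k} {x} {xs} (fits i i<len fit) =
  subst (SquareSide k (x ∷ xs)) (+-suc k i) (fits (suc i) (s≤s i<len) (subst (_≤ row xs i) (sym (+-suc k i)) fit))

SquareSide-⊔ : ∀ {k μ u v} → SquareSide k μ u → SquareSide k μ v → SquareSide k μ (u ⊔ v)
SquareSide-⊔ {k} {μ} {u} {v} su sv with ⊔-sel u v
... | inj₁ eq = subst (SquareSide k μ) (sym eq) su
... | inj₂ eq = subst (SquareSide k μ) (sym eq) sv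

sqFrom-side : ∀ k μ → SquareSide k μ (sqFrom k μ)
sqFrom-side k []       = none
sqFrom-side k (x ∷ xs) with k ≤ᵇ x | ≤ᵇ-reflects-≤ k x
... | false | ofⁿ _   = SquareSide-∷ (sqFrom-side (suc k) xs)
... | true  | ofʸ k≤x =
  SquareSide-⊔ (subst (SquareSide k (x ∷ xs)) (+-identityʳ k) (fits 0 (s≤s z≤n) (subst (_≤ x) (sym (+-identityʳ k)) k≤x)))
               (SquareSide-∷ (sqFrom-side (suc k) xs))

sqFrom-∷-≥ : ∀ k x xs → sqFrom (suc k) xs ≤ sqFrom k (x ∷ xs)
sqFrom-∷-≥ k x xs with k ≤ᵇ x
... | false = ≤-refl
... | true  = m≤n⊔m k _

sqFrom-maximal : ∀ k μ i → i < length μ → k + i ≤ row μ i → k + i ≤ sqFrom k μ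
sqFrom-maximal k (x ∷ xs) zero    _ fit with k ≤ᵇ x | ≤ᵇ-reflects-≤ k x
... | false | ofⁿ k≰x = ⊥-elim (k≰x (subst (_≤ x) (+-identityʳ k) fit))
... | true  | ofʸ _   = ≤-trans (≤-reflexive (+-identityʳ k)) (m≤m⊔n k _)
sqFrom-maximal k (x ∷ xs) (suc i) (s≤s i<len) fit = begin
  k + suc i           ≡⟨ +-suc k i ⟩
  suc k + i           ≤⟨ sqFrom-maximal (suc k) xs i i<len (subst (_≤ row xs i) (+-suc k i) fit) ⟩
  sqFrom (suc k) xs   ≤⟨ sqFrom-∷-≥ k x xs ⟩
  sqFrom k (x ∷ xs)   ∎
  where open ≤-Reasoning

sq≤length : ∀ μ → sq μ ≤ length μ
sq≤length μ with sq μ | sqFrom-side 1 μ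
... | _ | none           = z≤n
... | _ | fits i i<len _ = i<len

sq≤row : ∀ μ → 1 ≤ sq μ → sq μ ≤ row μ (sq μ ∸ 1)
sq≤row μ pos with sq μ | sqFrom-side 1 μ
... | _ | fits i _ fit = fit

row-sq≤sq : ∀ μ → row μ (sq μ) ≤ sq μ
row-sq≤sq μ with row μ (sq μ) ≤? sq μ
... | yes fit  = fit
... | no unfit = ⊥-elim (1+n≰n (sqFrom-maximal 1 μ (sq μ) (row-pos⇒<length μ (sq μ) (≤-trans (s≤s z≤n) (≰⇒> unfit))) (≰⇒> unfit)))

muRem≡drop : ∀ lam j → muRem lam j ≡ drop (sumTo (dSide lam) j) lam
muRem≡drop lam zero    = refl
muRem≡drop lam (suc j) =
  trans (cong (drop (sq (muRem lam j))) (muRem≡drop lam j))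
        (drop-drop (sumTo (dSide lam) j) (sq (muRem lam j)) lam)

row-muRem : ∀ lam j i → row (muRem lam j) i ≡ row lam (sumTo (dSide lam) j + i)
row-muRem lam j i = trans (cong (λ μ → row μ i) (muRem≡drop lam j)) (row-drop (sumTo (dSide lam) j) lam i)

module _ {lam : List ℕ} (sorted : Linked _≥_ lam) where

  private
    d D : ℕ → ℕ
    d = dSide lam
    D = sumTo d

  row≥dSide : ∀ k m → m < D k → d k ≤ row lam m
  row≥dSide (suc k) m m<D with sq (muRem lam k) | sqFrom-side 1 (muRem lam k)
  ... | _ | none           = z≤n
  ... | _ | fits i _ fit = begin
    suc i                      ≤⟨ fit ⟩
    row (muRem lam k) i        ≡⟨ row-muRem lam k i ⟩
    row lam (D k + i)          ≤⟨ row-antitone sorted (≤-pred (subst (m <_) (+-suc (D k) i) m<D)) ⟩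
    row lam m                  ∎
    where open ≤-Reasoning

  row≤dSide : ∀ k m → 1 ≤ k → D k ≤ m → row lam m ≤ d k
  row≤dSide (suc k) m _ D≤m = begin
    row lam m                   ≤⟨ row-antitone sorted D≤m ⟩
    row lam (D k + s)           ≡⟨ row-muRem lam k s ⟨
    row (muRem lam k) s         ≤⟨ row-sq≤sq (muRem lam k) ⟩
    s                           ∎
    where
    open ≤-Reasoning
    s : ℕ
    s = sq (muRem lam k)

  muRight-short⇔ : ∀ k → 1 ≤ d k → length (muRight lam k) < d k ⇔ row lam (D k ∸ 1) ≤ d k
  muRight-short⇔ (suc k) pos with sq (muRem lam k) | sqFrom-side 1 (muRem lam k) | sq≤length (muRem lam k)
  ... | _ | fits i _ _ | s≤len =
    subst (λ r → countAbove (suc i) (take (suc i) μ) < suc i ⇔ r ≤ suc i) row-eq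
          (countAbove-take<⇔ μ-sorted (suc i) i s≤len)
    where
    μ : List ℕ
    μ = muRem lam k
    μ-sorted : Linked _≥_ μ
    μ-sorted = subst (Linked _≥_) (sym (muRem≡drop lam k)) (Linked-drop (D k) sorted)
    row-eq : row μ i ≡ row lam (D k + suc i ∸ 1)
    row-eq = trans (row-muRem lam k i) (cong (row lam) (sym (+-∸-assoc (D k) (s≤s (z≤n {i})))))

dropLast-prefix : ∀ n xs (l : List ℕ) → xs ≡ take (length xs) l → dropLast n xs ≡ take (length xs ∸ n) l
dropLast-prefix n xs l prefix = begin
  dropLast n xs                                 ≡⟨ dropLast≡take n xs ⟩
  take (length xs ∸ n) xs                       ≡⟨ cong (take (length xs ∸ n)) prefix ⟩
  take (length xs ∸ n) (take (length xs) l)     ≡⟨ take-take (length xs ∸ n) (length xs) l ⟩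
  take ((length xs ∸ n) ⊓ length xs) l          ≡⟨ cong (λ m → take m l) (m≤n⇒m⊓n≡m (m∸n≤m (length xs) n)) ⟩
  take (length xs ∸ n) l                        ∎
  where open ≡-Reasoning

nuRem-prefix : ∀ lam j → nuRem lam j ≡ take (length (nuRem lam j)) lam
nuRem-prefix lam zero    = sym (take-all (length lam) lam ≤-refl)
nuRem-prefix lam (suc j) =
  trans (dropLast-prefix cut ν lam (nuRem-prefix lam j))
        (cong (λ m → take m lam) (sym (length-dropLast cut ν)))
  where
  ν : List ℕ
  ν = nuRem lam j
  cut : ℕ
  cut = lastPart ν ⊓ length ν

length-nuRem-suc : ∀ lam j → length (nuRem lam (suc j)) ≡ length (nuRem lam j) ∸ bSide lam (suc j)
length-nuRem-suc lam j = begin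
  length (dropLast (b ⊓ t) ν)  ≡⟨ length-dropLast (b ⊓ t) ν ⟩
  t ∸ (b ⊓ t)                  ≡⟨ ∸-distribˡ-⊓-⊔ t b t ⟩
  (t ∸ b) ⊔ (t ∸ t)            ≡⟨ cong ((t ∸ b) ⊔_) (n∸n≡0 t) ⟩
  (t ∸ b) ⊔ 0                  ≡⟨ ⊔-identityʳ (t ∸ b) ⟩
  t ∸ b                        ∎
  where
  open ≡-Reasoning
  ν : List ℕ
  ν = nuRem lam j
  t b : ℕ
  t = length ν
  b = lastPart ν

bSide-suc : ∀ lam j → 1 ≤ length (nuRem lam j) → bSide lam (suc j) ≡ row lam (length (nuRem lam j) ∸ 1)
bSide-suc lam j pos = begin
  lastPart ν                 ≡⟨ lastPart≡row ν ⟩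
  row ν (t ∸ 1)              ≡⟨ cong (λ xs → row xs (t ∸ 1)) (nuRem-prefix lam j) ⟩
  row (take t lam) (t ∸ 1)   ≡⟨ row-take t lam (∸-monoʳ-< {o = 0} (s≤s z≤n) pos) ⟩
  row lam (t ∸ 1)            ∎
  where
  open ≡-Reasoning
  ν : List ℕ
  ν = nuRem lam j
  t : ℕ
  t = length ν

module BottomSquares (lam : List ℕ) (sorted : Linked _≥_ lam) (n : ℕ)
  (d-pos : ∀ k → 1 ≤ k → k ≤ n → 1 ≤ dSide lam k)
  (d-sum : sumTo (dSide lam) n ≡ length lam) where

  d : ℕ → ℕ
  d = dSide lam

  D : ℕ → ℕ
  D = sumTo d

  height : ℕ → ℕ
  height j = length (nuRem lam j)

  Short : ℕ → Set
  Short k = length (muRight lam k) < d k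

  ShortFrom : ℕ → Set
  ShortFrom a = ∀ k → a ≤ k → k ≤ n → Short k

  record Invariant (j : ℕ) : Set where
    field
      hD≤hB       : hD lam (suc n) j ≤ hB lam j
      hB<hD       : suc j ≤ n → hB lam j < hD lam (suc n) (suc j)
      -- Not for j = n: the last bottom square may be wider than the rows that remain.
      height+hB   : suc j ≤ n → height j + hB lam j ≡ D n
      hD≡hB⇔short : hD lam (suc n) j ≡ hB lam j ⇔ ShortFrom (suc n ∸ j)

  invariant-zero : Invariant 0
  invariant-zero = record
    { hD≤hB       = z≤n
    ; hB<hD       = λ 1≤n → d-pos n 1≤n ≤-refl
    ; height+hB   = λ _ → trans (+-identityʳ (length lam)) (sym d-sum)
    ; hD≡hB⇔short = mk⇔ (λ _ k n<k k≤n → ⊥-elim (1+n≰n (≤-trans n<k k≤n))) (λ _ → refl)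
    }

  module Step {j} (j<n : suc j ≤ n) (I : Invariant j) where
    open Invariant I

    Y X t β k k′ : ℕ
    Y = hD lam (suc n) j
    X = hB lam j
    t = height j
    β = bSide lam (suc j)
    k = n ∸ j
    k′ = n ∸ suc j

    k≡1+k′ : k ≡ suc k′
    k≡1+k′ = +-∸-assoc 1 j<n

    1≤k : 1 ≤ k
    1≤k = m<n⇒0<n∸m j<n

    t+X≡Y+Dk : t + X ≡ Y + D k
    t+X≡Y+Dk = trans (height+hB j<n) (sym (sumTo-reverse+sumTo d n j (<⇒≤ j<n)))

    Dk≡Dk′+dk : D k ≡ D k′ + d k
    Dk≡Dk′+dk = trans (cong D k≡1+k′) (cong (λ m → D k′ + d m) (sym k≡1+k′))

    -- D k′ < t ≤ D k: the last row of ν^(j) lies in the k-th Durfee square.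
    t≤Dk : t ≤ D k
    t≤Dk = +≡+⇒≤ (trans t+X≡Y+Dk (+-comm Y (D k))) hD≤hB

    Dk′<t : D k′ < t
    Dk′<t = +≡+⇒> (trans t+X≡Y+Dk regroup) (hB<hD j<n)
      where
      regroup : Y + D k ≡ D k′ + (Y + d k)
      regroup = trans (cong (Y +_) Dk≡Dk′+dk) (x∙yz≈y∙xz Y (D k′) (d k))

    1≤t : 1 ≤ t
    1≤t = ≤-trans (s≤s z≤n) Dk′<t

    β≡row : β ≡ row lam (t ∸ 1)
    β≡row = bSide-suc lam j 1≤t

    dk≤β : d k ≤ β
    dk≤β = subst (d k ≤_) (sym β≡row)
                 (row≥dSide sorted k (t ∸ 1) (<-≤-trans (∸-monoʳ-< {o = 0} (s≤s z≤n) 1≤t) t≤Dk))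

    β≤dk′ : suc (suc j) ≤ n → β ≤ d k′
    β≤dk′ 2+j≤n = subst (_≤ d k′) (sym β≡row)
                        (row≤dSide sorted k′ (t ∸ 1) (m<n⇒0<n∸m 2+j≤n) (∸-monoˡ-≤ 1 Dk′<t))

    β≤t : suc (suc j) ≤ n → β ≤ t
    β≤t 2+j≤n = ≤-trans (β≤dk′ 2+j≤n) (≤-trans (sumTo-≥-last d k′ (m<n⇒0<n∸m 2+j≤n)) (<⇒≤ Dk′<t))

    short⇔β≤dk : Y ≡ X → Short k ⇔ β ≤ d k
    short⇔β≤dk Y≡X = subst (λ b → Short k ⇔ b ≤ d k) (sym (trans β≡row (cong (λ m → row lam (m ∸ 1)) t≡Dk)))
                           (muRight-short⇔ sorted k (d-pos k 1≤k (m∸n≤m n j)))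
      where
      t≡Dk : t ≡ D k
      t≡Dk = +-cancelʳ-≡ X t (D k) (trans t+X≡Y+Dk (trans (cong (_+ D k) Y≡X) (+-comm X (D k))))

    invariant-suc : Invariant (suc j)
    invariant-suc = record
      { hD≤hB       = +-mono-≤ hD≤hB dk≤β
      ; hB<hD       = λ 2+j≤n → +-mono-<-≤ (hB<hD j<n) (β≤dk′ 2+j≤n)
      ; height+hB   = height+hB′
      ; hD≡hB⇔short = mk⇔ to from
      }
      where
      height+hB′ : suc (suc j) ≤ n → height (suc j) + (X + β) ≡ D n
      height+hB′ 2+j≤n = begin
        height (suc j) + (X + β)  ≡⟨ cong (_+ (X + β)) (length-nuRem-suc lam j) ⟩
        t ∸ β + (X + β)           ≡⟨ x∙yz≈y∙xz (t ∸ β) X β ⟩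
        X + (t ∸ β + β)           ≡⟨ cong (X +_) (m∸n+n≡m (β≤t 2+j≤n)) ⟩
        X + t                     ≡⟨ +-comm X t ⟩
        t + X                     ≡⟨ height+hB j<n ⟩
        D n                       ∎
        where open ≡-Reasoning
      1+n∸j≡1+k : suc n ∸ j ≡ suc k
      1+n∸j≡1+k = +-∸-assoc 1 (<⇒≤ j<n)
      to : Y + d k ≡ X + β → ShortFrom k
      to eq k″ k≤k″ k″≤n with +-≡-split hD≤hB dk≤β eq | m≤n⇒m<n∨m≡n k≤k″
      ... | Y≡X , _    | inj₁ k<k″ = Equivalence.to hD≡hB⇔short Y≡X k″ (subst (_≤ k″) (sym 1+n∸j≡1+k) k<k″) k″≤n
      ... | Y≡X , dk≡β | inj₂ refl = Equivalence.from (short⇔β≤dk Y≡X) (≤-reflexive (sym dk≡β))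
      from : ShortFrom k → Y + d k ≡ X + β
      from short = cong₂ _+_ Y≡X (≤-antisym dk≤β (Equivalence.to (short⇔β≤dk Y≡X) (short k ≤-refl (m∸n≤m n j))))
        where
        Y≡X : Y ≡ X
        Y≡X = Equivalence.from hD≡hB⇔short
                (λ k″ 1+n∸j≤k″ → short k″ (≤-trans (n≤1+n k) (subst (_≤ k″) 1+n∸j≡1+k 1+n∸j≤k″)))

  invariant : ∀ j → j ≤ n → Invariant j
  invariant zero    _   = invariant-zero
  invariant (suc j) j<n = Step.invariant-suc j<n (invariant j (<⇒≤ j<n))

proposition3p2 : (r : ℕ) → 2 ≤ r → (lam : List ℕ) → IsPartition lam →
    (∀ j → 1 ≤ j → j ≤ r ∸ 1 → 1 ≤ dSide lam j) →
    dSide lam r ≡ 0 →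
    sumTo (dSide lam) (r ∸ 1) ≡ length lam →
    ∀ j → 1 ≤ j → j ≤ r ∸ 1 →
      (hD lam r j ≤ hB lam j)
      × (j + 1 ≤ r ∸ 1 → hB lam j < hD lam r (j + 1))
      × ((hD lam r j ≡ hB lam j)
         ⇔ (∀ k → r ∸ j ≤ k → k ≤ r ∸ 1 → length (muRight lam k) < dSide lam k))
proposition3p2 zero    ()
proposition3p2 (suc n) _  lam (_ , sorted) d-pos _ d-sum j _ j≤n =
  hD≤hB , hB<hD′ , hD≡hB⇔short
  where
  open BottomSquares lam sorted n d-pos d-sum
  open Invariant (invariant j j≤n)
  hB<hD′ : j + 1 ≤ n → hB lam j < hD lam (suc n) (j + 1)
  hB<hD′ j+1≤n rewrite +-comm j 1 = hB<hD j+1≤n
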